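{- Operation (sb3') is a combination of Operations (sb3) and (sb4): for any vertex-disjoint signed bi-graphs $(G_1,\sigma_1)$, $(G_2,\sigma_2)$ and edges $e_i$ of $G_i$ with ends $x_i,y_i$ ($i=1,2$), the signed bi-graph produced by (sb3') from these data can be obtained from $(G_1,\sigma_1)$ and $(G_2,\sigma_2)$ by applications of Operations (sb3) and (sb4).
   Context: A bi-graph is a loopless multigraph with at most two edges between any two distinct vertices. A signed bi-graph $(G,\sigma)$ is a bi-graph $G$ with a map $\sigma\colon E(G)\to\{1,-1\}$ such that any two parallel edges have distinct signs; an edge $e$ is positive if $\sigma(e)=1$, negative otherwise. (sb3) Given two vertex-disjoint signed bi-graphs $(H_1,\tau_1)$, $(H_2,\tau_2)$, a vertex $v$ of $H_1$ and a positive edge $e$ of $H_2$ with ends $x,y$: split $v$ into two new vertices $v_1,v_2$ (each edge formerly incident with $v$ becomes incident with exactly one of $v_1,v_2$, keeping its other end and its sign), remove $e$, and identify $v_1$ with $x$ and $v_2$ with $y$. (sb4) Switching at a vertex $v$: replace $\sigma(e)$ by $-\sigma(e)$ for every edge $e$ incident with $v$. (sb3') Given vertex-disjoint signed bi-graphs $(G_1,\sigma_1)$, $(G_2,\sigma_2)$ and for each $i\in\{1,2\}$ an edge $e_i$ of $G_i$ with ends $x_i,y_i$: form $(G,\sigma)$ from $G_1\cup G_2$ by removing $e_1$ and $e_2$, identifying $x_1$ with $x_2$, and adding a new edge $e$ between $y_1$ and $y_2$ with $\sigma(e)=\sigma_1(e_1)\sigma_2(e_2)$. -}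

module Defs where

open import Data.Nat using (ℕ)
open import Data.Fin using (Fin; _≟_)
open import Data.Bool using (Bool; true; false; if_then_else_; _∨_)
open import Data.Sign using (Sign; opposite) renaming (_*_ to _·_)
open import Data.Sum using (_⊎_; inj₁; inj₂)
open import Data.Product using (Σ; _×_; _,_)
open import Data.Unit using (⊤; tt)
open import Relation.Binary.PropositionalEquality using (_≡_; _≢_)
open import Relation.Nullary using (yes; no)
open import Relation.Nullary.Decidable using (isYes)
open import Function.Bundles using (_⤖_; Bijection)

Joins : {V E : Set} (d₁ d₂ : E → V) → V → V → E → Set
Joins d₁ d₂ u w f = (d₁ f ≡ u × d₂ f ≡ w) ⊎ (d₁ f ≡ w × d₂ f ≡ u)

-- Loopless, and any two distinct parallel edges have distinct signs
-- (hence at most two edges between two vertices).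

record SBG : Set where
  field
    nV nE    : ℕ
    end₁     : Fin nE → Fin nV
    end₂     : Fin nE → Fin nV
    sign     : Fin nE → Sign
    loopless : ∀ e → end₁ e ≢ end₂ e
    biSigned : ∀ e f → e ≢ f → Joins end₁ end₂ (end₁ e) (end₂ e) f →
               sign e ≢ sign f
open SBG public

-- G realizes (is isomorphic to) the signed multigraph described by
-- vertex type VT, edge type ET, end maps d₁ d₂ and signs s.

Realizes : (G : SBG) {VT ET : Set} (d₁ d₂ : ET → VT) (s : ET → Sign) → Set
Realizes G {VT} {ET} d₁ d₂ s =
  Σ (Fin (nV G) ⤖ VT) λ α → Σ (Fin (nE G) ⤖ ET) λ β →
    ∀ g → Joins d₁ d₂ (Bijection.to α (end₁ G g)) (Bijection.to α (end₂ G g))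
                      (Bijection.to β g)
        × sign G g ≡ s (Bijection.to β g)

incident : (H : SBG) → Fin (nV H) → Fin (nE H) → Bool
incident H v f = isYes (end₁ H f ≟ v) ∨ isYes (end₂ H f ≟ v)

switchSign : (H : SBG) → Fin (nV H) → Fin (nE H) → Sign
switchSign H v f = if incident H v f then opposite (sign H f) else sign H f

Sb4 : (H : SBG) → Fin (nV H) → SBG → Set
Sb4 H v G = Realizes G (end₁ H) (end₂ H) (switchSign H v)

-- (sb3) Split v of H₁ into v₁ (identified with x) and v₂ (identified
-- with y), where e is a positive edge of H₂ with ends x, y, and remove e.
-- side f = true means edge f (if incident with v) goes to v₁, else to v₂.

module Sb3Desc (H₁ H₂ : SBG) (v : Fin (nV H₁)) (e : Fin (nE H₂))
               (x y : Fin (nV H₂)) (side : Fin (nE H₁) → Bool) where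
  VT : Set
  VT = Σ (Fin (nV H₁)) (λ u → u ≢ v) ⊎ Fin (nV H₂)

  ET : Set
  ET = Fin (nE H₁) ⊎ Σ (Fin (nE H₂)) (λ f → f ≢ e)

  place : Fin (nE H₁) → Fin (nV H₁) → VT
  place f u with u ≟ v
  ... | yes _   = inj₂ (if side f then x else y)
  ... | no  u≢v = inj₁ (u , u≢v)

  d₁ d₂ : ET → VT
  d₁ (inj₁ f)       = place f (end₁ H₁ f)
  d₁ (inj₂ (f , _)) = inj₂ (end₁ H₂ f)
  d₂ (inj₁ f)       = place f (end₂ H₁ f)
  d₂ (inj₂ (f , _)) = inj₂ (end₂ H₂ f)

  s : ET → Sign
  s (inj₁ f)       = sign H₁ f
  s (inj₂ (f , _)) = sign H₂ f

Sb3 : SBG → SBG → SBG → Set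
Sb3 H₁ H₂ G =
  Σ (Fin (nV H₁)) λ v → Σ (Fin (nE H₂)) λ e →
  Σ (Fin (nV H₂)) λ x → Σ (Fin (nV H₂)) λ y →
  Σ (Fin (nE H₁) → Bool) λ side →
    sign H₂ e ≡ Sign.+ × Joins (end₁ H₂) (end₂ H₂) x y e ×
    Realizes G (Sb3Desc.d₁ H₁ H₂ v e x y side) (Sb3Desc.d₂ H₁ H₂ v e x y side)
               (Sb3Desc.s H₁ H₂ v e x y side)

-- (sb3') Remove e₁ (ends x₁,y₁) and e₂ (ends x₂,y₂), identify x₁ with x₂,
-- add new edge y₁y₂ with sign σ₁(e₁)σ₂(e₂).

module Sb3'Desc (G₁ G₂ : SBG) (e₁ : Fin (nE G₁)) (x₁ y₁ : Fin (nV G₁))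
                (e₂ : Fin (nE G₂)) (x₂ y₂ : Fin (nV G₂)) where
  VT : Set
  VT = Fin (nV G₁) ⊎ Σ (Fin (nV G₂)) (λ w → w ≢ x₂)

  ET : Set
  ET = (Σ (Fin (nE G₁)) (λ f → f ≢ e₁) ⊎ Σ (Fin (nE G₂)) (λ f → f ≢ e₂)) ⊎ ⊤

  map₂ : Fin (nV G₂) → VT
  map₂ w with w ≟ x₂
  ... | yes _   = inj₁ x₁
  ... | no  w≢x = inj₂ (w , w≢x)

  d₁ d₂ : ET → VT
  d₁ (inj₁ (inj₁ (f , _))) = inj₁ (end₁ G₁ f)
  d₁ (inj₁ (inj₂ (f , _))) = map₂ (end₁ G₂ f)
  d₁ (inj₂ tt)             = inj₁ y₁
  d₂ (inj₁ (inj₁ (f , _))) = inj₁ (end₂ G₁ f)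
  d₂ (inj₁ (inj₂ (f , _))) = map₂ (end₂ G₂ f)
  d₂ (inj₂ tt)             = map₂ y₂

  s : ET → Sign
  s (inj₁ (inj₁ (f , _))) = sign G₁ f
  s (inj₁ (inj₂ (f , _))) = sign G₂ f
  s (inj₂ tt)             = sign G₁ e₁ · sign G₂ e₂

Sb3' : (G₁ G₂ : SBG) (e₁ : Fin (nE G₁)) (x₁ y₁ : Fin (nV G₁))
       (e₂ : Fin (nE G₂)) (x₂ y₂ : Fin (nV G₂)) → SBG → Set
Sb3' G₁ G₂ e₁ x₁ y₁ e₂ x₂ y₂ G =
  Realizes G (Sb3'Desc.d₁ G₁ G₂ e₁ x₁ y₁ e₂ x₂ y₂)
             (Sb3'Desc.d₂ G₁ G₂ e₁ x₁ y₁ e₂ x₂ y₂)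
             (Sb3'Desc.s G₁ G₂ e₁ x₁ y₁ e₂ x₂ y₂)

data Obtainable (G₁ G₂ : SBG) : SBG → Set where
  base₁ : Obtainable G₁ G₂ G₁
  base₂ : Obtainable G₁ G₂ G₂
  op3   : ∀ {H₁ H₂ G} → Obtainable G₁ G₂ H₁ → Obtainable G₁ G₂ H₂ →
          Sb3 H₁ H₂ G → Obtainable G₁ G₂ G
  op4   : ∀ {H G} → Obtainable G₁ G₂ H → (v : Fin (nV H)) →
          Sb4 H v G → Obtainable G₁ G₂ G

-- Switch G₁ at y₁ by the sign t = σ₁(e₁), which makes e₁ positive. Applying
-- (sb3) to G₂ and this switched graph, splitting x₂ so that e₂ goes to y₁ and
-- all other edges at x₂ go to x₁, yields the (sb3') graph except that the
-- edges at y₁ carry the switched signs; switching once more at y₁ by t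
-- restores them and gives the new edge y₁y₂ the sign t·σ₂(e₂). Switching by
-- t = + is the identity, which is realized as two switchings.
module Submission where

open import Defs
open import Data.Bool using (Bool; true; false; if_then_else_; _∨_; not)
open import Data.Bool.Properties using (∨-comm; ∨-zeroʳ)
open import Data.Empty using (⊥-elim)
open import Data.Fin using (Fin; _≟_)
open import Data.Product using (_×_; _,_; proj₁; proj₂)
open import Data.Sign using (Sign) renaming (_*_ to _·_)
open import Data.Sign.Properties using (*-assoc; s*s≡+; *-cancelˡ-≡)
open import Data.Sum using (_⊎_; inj₁; inj₂; swap)
open import Data.Sum.Properties using (swap-↔)
open import Data.Unit using (tt)
open import Function using (id; _∘′_)
open import Function.Bundles using (_⤖_; Bijection; mk⤖)
open import Function.Consequences.Propositional using (strictlySurjective⇒surjective)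
open import Function.Construct.Composition using (_⤖-∘_)
open import Function.Construct.Identity using (⤖-id)
open import Function.Properties.Inverse using (↔⇒⤖)
open import Relation.Binary.PropositionalEquality
open import Relation.Nullary using (yes; no)
open import Relation.Nullary.Decidable using (isYes; isYes≗does; dec-true; dec-false)

isYes-≟-refl : ∀ {n} (a : Fin n) → isYes (a ≟ a) ≡ true
isYes-≟-refl a = trans (isYes≗does (a ≟ a)) (dec-true (a ≟ a) refl)

isYes-≟-≢ : ∀ {n} {a b : Fin n} → a ≢ b → isYes (a ≟ b) ≡ false
isYes-≟-≢ {a = a} {b} a≢b = trans (isYes≗does (a ≟ b)) (dec-false (a ≟ b) a≢b)

module _ {V E : Set} {d₁ d₂ : E → V} where

  Joins-trans : {W F : Set} {c₁ c₂ : F → W} (φ : V → W) {u w : V} {h : E} {k : F} →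
                Joins d₁ d₂ u w h → Joins c₁ c₂ (φ (d₁ h)) (φ (d₂ h)) k →
                Joins c₁ c₂ (φ u) (φ w) k
  Joins-trans φ (inj₁ (refl , refl)) j = j
  Joins-trans φ (inj₂ (refl , refl)) j = swap j

  Joins-∨ : (P : V → Bool) {u w : V} {f : E} → Joins d₁ d₂ u w f →
            P u ∨ P w ≡ P (d₁ f) ∨ P (d₂ f)
  Joins-∨ P (inj₁ (refl , refl)) = refl
  Joins-∨ P (inj₂ (refl , refl)) = ∨-comm (P (d₂ _)) (P (d₁ _))

  Joins-reflect : {U : Set} {φ : U → V} → (∀ {u u′} → φ u ≡ φ u′ → u ≡ u′) →
                  ∀ {u w u′ w′ h} → Joins d₁ d₂ (φ u) (φ w) h → Joins d₁ d₂ (φ u′) (φ w′) h →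
                  (u′ ≡ u × w′ ≡ w) ⊎ (u′ ≡ w × w′ ≡ u)
  Joins-reflect inj (inj₁ (p , q)) (inj₁ (r , s)) = inj₁ (inj (trans (sym r) p) , inj (trans (sym s) q))
  Joins-reflect inj (inj₁ (p , q)) (inj₂ (r , s)) = inj₂ (inj (trans (sym s) q) , inj (trans (sym r) p))
  Joins-reflect inj (inj₂ (p , q)) (inj₁ (r , s)) = inj₂ (inj (trans (sym r) p) , inj (trans (sym s) q))
  Joins-reflect inj (inj₂ (p , q)) (inj₂ (r , s)) = inj₁ (inj (trans (sym s) q) , inj (trans (sym r) p))

Joins⇒≢ : (H : SBG) {e : Fin (nE H)} {x y : Fin (nV H)} →
          Joins (end₁ H) (end₂ H) x y e → x ≢ y
Joins⇒≢ H {e} (inj₁ (refl , refl)) = loopless H e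
Joins⇒≢ H {e} (inj₂ (refl , refl)) = loopless H e ∘′ sym

incident-parallel : (H : SBG) (v : Fin (nV H)) {e f : Fin (nE H)} →
                    Joins (end₁ H) (end₂ H) (end₁ H e) (end₂ H e) f →
                    incident H v e ≡ incident H v f
incident-parallel H v = Joins-∨ {d₁ = end₁ H} {end₂ H} (λ u → isYes (u ≟ v))

incident-end : (H : SBG) {v x : Fin (nV H)} {e : Fin (nE H)} →
               Joins (end₁ H) (end₂ H) x v e → incident H v e ≡ true
incident-end H {v} {x} {e} j = begin
  incident H v e                     ≡⟨ Joins-∨ {d₁ = end₁ H} {end₂ H} (λ u → isYes (u ≟ v)) j ⟨
  isYes (x ≟ v) ∨ isYes (v ≟ v)      ≡⟨ cong (isYes (x ≟ v) ∨_) (isYes-≟-refl v) ⟩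
  isYes (x ≟ v) ∨ true               ≡⟨ ∨-zeroʳ (isYes (x ≟ v)) ⟩
  true                               ∎
  where open ≡-Reasoning

scaleIf : Bool → Sign → Sign → Sign
scaleIf b t σ = if b then t · σ else σ

scaleIf-injective : ∀ b t {σ σ′} → scaleIf b t σ ≡ scaleIf b t σ′ → σ ≡ σ′
scaleIf-injective true  t = *-cancelˡ-≡ t _ _
scaleIf-injective false t = id

scaleIf-involutive : ∀ b t σ → scaleIf b t (scaleIf b t σ) ≡ σ
scaleIf-involutive true  t σ = trans (sym (*-assoc t t σ)) (cong (_· σ) (s*s≡+ t))
scaleIf-involutive false t σ = refl

scaleIf-identity : ∀ b σ → scaleIf b Sign.+ σ ≡ σ
scaleIf-identity true  σ = refl
scaleIf-identity false σ = refl

-- (sb4) is the case t = -, definitionally.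
twistSign : Sign → (H : SBG) → Fin (nV H) → Fin (nE H) → Sign
twistSign t H v f = scaleIf (incident H v f) t (sign H f)

twistSign-biSigned : ∀ t (H : SBG) v e f → e ≢ f →
                     Joins (end₁ H) (end₂ H) (end₁ H e) (end₂ H e) f →
                     twistSign t H v e ≢ twistSign t H v f
twistSign-biSigned t H v e f e≢f j eq = biSigned H e f e≢f j
  (scaleIf-injective (incident H v e) t
    (trans eq (cong (λ b → scaleIf b t (sign H f)) (sym (incident-parallel H v j)))))

twist : Sign → (H : SBG) → Fin (nV H) → SBG
twist t H v = record
  { nV = nV H ; nE = nE H ; end₁ = end₁ H ; end₂ = end₂ H
  ; sign = twistSign t H v ; loopless = loopless H ; biSigned = twistSign-biSigned t H v }

realizes-self : (K : SBG) → Realizes K (end₁ K) (end₂ K) (sign K)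
realizes-self K = ⤖-id _ , ⤖-id _ , λ g → inj₁ (refl , refl) , refl

Realizes-sign-cong : {K : SBG} {V E : Set} {d₁ d₂ : E → V} {s s′ : E → Sign} →
                     (∀ f → s f ≡ s′ f) → Realizes K d₁ d₂ s → Realizes K d₁ d₂ s′
Realizes-sign-cong s≗s′ (α , β , R) =
  α , β , λ g → proj₁ (R g) , trans (proj₂ (R g)) (s≗s′ (Bijection.to β g))

obtainable-twist : ∀ {G₁ G₂ H K} → Obtainable G₁ G₂ H → (t : Sign) (v : Fin (nV H)) →
                   Realizes K (end₁ H) (end₂ H) (twistSign t H v) → Obtainable G₁ G₂ K
obtainable-twist o Sign.- v r = op4 o v r
obtainable-twist {H = H} {K} o Sign.+ v r =
  op4 (op4 {G = H⁻} o v (realizes-self H⁻)) v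
      (Realizes-sign-cong {K = K} {d₁ = end₁ H} {end₂ H} switch-back r)
  where
    H⁻ : SBG
    H⁻ = twist Sign.- H v

    switch-back : ∀ g → twistSign Sign.+ H v g ≡ twistSign Sign.- H⁻ v g
    switch-back g = trans (scaleIf-identity (incident H v g) (sign H g))
                          (sym (scaleIf-involutive (incident H v g) Sign.- (sign H g)))

module Realization {G : SBG} {V E : Set} {d₁ d₂ : E → V} {s : E → Sign}
                   (r : Realizes G d₁ d₂ s) where

  α : Fin (nV G) ⤖ V
  α = proj₁ r

  β : Fin (nE G) ⤖ E
  β = proj₁ (proj₂ r)

  open Bijection α public using () renaming (to to α⟨_⟩)
  open Bijection β public using () renaming (to to β⟨_⟩)

  realized-ends : ∀ g → Joins d₁ d₂ α⟨ end₁ G g ⟩ α⟨ end₂ G g ⟩ β⟨ g ⟩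
  realized-ends g = proj₁ (proj₂ (proj₂ r) g)

  realized-sign : ∀ g → sign G g ≡ s β⟨ g ⟩
  realized-sign g = proj₂ (proj₂ (proj₂ r) g)

  realized-parallel⇒≡ : ∀ a c → Joins d₁ d₂ (d₁ β⟨ a ⟩) (d₂ β⟨ a ⟩) β⟨ c ⟩ →
                        s β⟨ a ⟩ ≡ s β⟨ c ⟩ → a ≡ c
  realized-parallel⇒≡ a c j σ with a ≟ c
  ... | yes a≡c = a≡c
  ... | no a≢c  = ⊥-elim (biSigned G a c a≢c parallel same-sign)
    where
      same-sign : sign G a ≡ sign G c
      same-sign = trans (realized-sign a) (trans σ (sym (realized-sign c)))

      parallel : Joins (end₁ G) (end₂ G) (end₁ G a) (end₂ G a) c
      parallel = Joins-reflect {d₁ = d₁} {d₂} (Bijection.injective α)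
        (Joins-trans {d₁ = d₁} {d₂} {c₁ = d₁} {d₂} id (realized-ends a) j)
        (realized-ends c)

  incident-realized : (P : V → Bool) (w : Fin (nV G)) →
                      (∀ a → isYes (a ≟ w) ≡ P α⟨ a ⟩) →
                      ∀ g → incident G w g ≡ P (d₁ β⟨ g ⟩) ∨ P (d₂ β⟨ g ⟩)
  incident-realized P w P-at-w g =
    trans (cong₂ _∨_ (P-at-w (end₁ G g)) (P-at-w (end₂ G g)))
          (Joins-∨ {d₁ = d₁} {d₂} P (realized-ends g))

module Sb3'ViaSb3 (G₁ G₂ : SBG)
                  {e₁ : Fin (nE G₁)} {x₁ y₁ : Fin (nV G₁)} (j₁ : Joins (end₁ G₁) (end₂ G₁) x₁ y₁ e₁)
                  {e₂ : Fin (nE G₂)} {x₂ y₂ : Fin (nV G₂)} (j₂ : Joins (end₁ G₂) (end₂ G₂) x₂ y₂ e₂)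
                  where

  open Sb3'Desc G₁ G₂ e₁ x₁ y₁ e₂ x₂ y₂
    renaming (VT to VT′; ET to ET′; d₁ to d₁′; d₂ to d₂′; s to s′)

  t : Sign
  t = sign G₁ e₁

  G₁ᵗ : SBG
  G₁ᵗ = twist t G₁ y₁

  e₁-positive : sign G₁ᵗ e₁ ≡ Sign.+
  e₁-positive = trans (cong (λ b → scaleIf b t t) (incident-end G₁ j₁)) (s*s≡+ t)

  side : Fin (nE G₂) → Bool
  side f = not (isYes (f ≟ e₂))

  open Sb3Desc G₂ G₁ᵗ x₂ e₁ x₁ y₁ side

  place-side : ∀ f u → side f ≡ true → place f u ≡ swap (map₂ u)
  place-side f u side-f with u ≟ x₂
  ... | yes _ = cong (λ b → inj₂ (if b then x₁ else y₁)) side-f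
  ... | no  _ = refl

  place-away : ∀ f u → u ≢ x₂ → place f u ≡ swap (map₂ u)
  place-away f u u≢x₂ with u ≟ x₂
  ... | yes u≡x₂ = ⊥-elim (u≢x₂ u≡x₂)
  ... | no  _    = refl

  place-e₂-x₂ : place e₂ x₂ ≡ inj₂ y₁
  place-e₂-x₂ with x₂ ≟ x₂
  ... | yes _    = cong (λ b → inj₂ (if b then x₁ else y₁)) (cong not (isYes-≟-refl e₂))
  ... | no x₂≢x₂ = ⊥-elim (x₂≢x₂ refl)

  relabel : ET′ → ET
  relabel (inj₁ (inj₁ f))       = inj₂ f
  relabel (inj₁ (inj₂ (f , _))) = inj₁ f
  relabel (inj₂ tt)             = inj₁ e₂

  unrelabel : ET → ET′
  unrelabel (inj₁ f) with f ≟ e₂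
  ... | yes _    = inj₂ tt
  ... | no f≢e₂  = inj₁ (inj₂ (f , f≢e₂))
  unrelabel (inj₂ f) = inj₁ (inj₁ f)

  relabel-unrelabel : ∀ k → relabel (unrelabel k) ≡ k
  relabel-unrelabel (inj₁ f) with f ≟ e₂
  ... | yes refl = refl
  ... | no  _    = refl
  relabel-unrelabel (inj₂ f) = refl

  -- Without function extensionality the proofs of f ≢ e₂ cannot be identified, so
  -- relabel is injective only up to parallel edges of equal sign; by
  -- realized-parallel⇒≡ that is enough for the edge bijection below.
  relabel-merges-parallel : ∀ h k → relabel h ≡ relabel k →
                            Joins d₁′ d₂′ (d₁′ h) (d₂′ h) k × s′ h ≡ s′ k
  relabel-merges-parallel (inj₁ (inj₁ _)) (inj₁ (inj₁ _)) refl = inj₁ (refl , refl) , refl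
  relabel-merges-parallel (inj₁ (inj₂ _)) (inj₁ (inj₂ _)) refl = inj₁ (refl , refl) , refl
  relabel-merges-parallel (inj₂ tt)       (inj₂ tt)       refl = inj₁ (refl , refl) , refl
  relabel-merges-parallel (inj₁ (inj₂ (_ , f≢e₂))) (inj₂ tt) refl = ⊥-elim (f≢e₂ refl)
  relabel-merges-parallel (inj₂ tt) (inj₁ (inj₂ (_ , f≢e₂))) refl = ⊥-elim (f≢e₂ refl)
  relabel-merges-parallel (inj₁ (inj₁ _)) (inj₁ (inj₂ _)) ()
  relabel-merges-parallel (inj₁ (inj₁ _)) (inj₂ tt)       ()
  relabel-merges-parallel (inj₁ (inj₂ _)) (inj₁ (inj₁ _)) ()
  relabel-merges-parallel (inj₂ tt)       (inj₁ (inj₁ _)) ()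

  relabel-ends : ∀ h → Joins d₁ d₂ (swap (d₁′ h)) (swap (d₂′ h)) (relabel h)
  relabel-ends (inj₁ (inj₁ _)) = inj₁ (refl , refl)
  relabel-ends (inj₁ (inj₂ (f , f≢e₂))) =
    inj₁ (place-side f (end₁ G₂ f) side-f , place-side f (end₂ G₂ f) side-f)
    where side-f = cong not (isYes-≟-≢ f≢e₂)
  relabel-ends (inj₂ tt) =
    subst₂ (λ u w → Joins d₁ d₂ u w (inj₁ e₂)) place-e₂-x₂ (place-away e₂ y₂ y₂≢x₂)
      (Joins-trans {d₁ = end₁ G₂} {end₂ G₂} {c₁ = d₁} {d₂} (place e₂) j₂ (inj₁ (refl , refl)))
    where y₂≢x₂ = Joins⇒≢ G₂ j₂ ∘′ sym

  -- VT′ has no decidable equality (its second summand carries proofs), so the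
  -- vertex y₁ is detected by this indicator.
  at-y₁ : VT′ → Bool
  at-y₁ (inj₁ u) = isYes (u ≟ y₁)
  at-y₁ (inj₂ _) = false

  at-y₁⇒≡ : ∀ u → at-y₁ u ≡ true → u ≡ inj₁ y₁
  at-y₁⇒≡ (inj₁ u) p with u ≟ y₁
  at-y₁⇒≡ (inj₁ u) p  | yes refl = refl
  at-y₁⇒≡ (inj₁ u) () | no _
  at-y₁⇒≡ (inj₂ _) ()

  at-y₁-map₂ : ∀ u → at-y₁ (map₂ u) ≡ false
  at-y₁-map₂ u with u ≟ x₂
  ... | yes _ = isYes-≟-≢ (Joins⇒≢ G₁ j₁)
  ... | no  _ = refl

  relabel-sign : ∀ h → scaleIf (at-y₁ (d₁′ h) ∨ at-y₁ (d₂′ h)) t (s′ h) ≡ s (relabel h)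
  relabel-sign (inj₁ (inj₁ _)) = refl
  relabel-sign (inj₁ (inj₂ (f , _)))
    rewrite at-y₁-map₂ (end₁ G₂ f) | at-y₁-map₂ (end₂ G₂ f) = refl
  relabel-sign (inj₂ tt) rewrite isYes-≟-refl y₁ = scaleIf-involutive true t (sign G₂ e₂)

  module _ (G : SBG) (r : Realizes G d₁′ d₂′ s′) where
    open Realization {G = G} {d₁ = d₁′} {d₂′} {s′} r

    w : Fin (nV G)
    w = Bijection.to⁻ α (inj₁ y₁)

    α⟨w⟩ : α⟨ w ⟩ ≡ inj₁ y₁
    α⟨w⟩ = proj₂ (Bijection.strictlySurjective α (inj₁ y₁))

    ≟w≡at-y₁ : ∀ a → isYes (a ≟ w) ≡ at-y₁ α⟨ a ⟩
    ≟w≡at-y₁ a with a ≟ w | at-y₁ α⟨ a ⟩ in at-y₁-a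
    ... | yes refl | _     =
      trans (sym (isYes-≟-refl y₁)) (trans (cong at-y₁ (sym α⟨w⟩)) at-y₁-a)
    ... | no  _    | false = refl
    ... | no  a≢w  | true  =
      ⊥-elim (a≢w (Bijection.injective α (trans (at-y₁⇒≡ _ at-y₁-a) (sym α⟨w⟩))))

    Gᵗ : SBG
    Gᵗ = twist t G w

    Gᵗ-by-sb3 : Sb3 G₂ G₁ᵗ Gᵗ
    Gᵗ-by-sb3 = x₂ , e₁ , x₁ , y₁ , side , e₁-positive , j₁ , vertices , edges , λ g →
      Joins-trans {d₁ = d₁′} {d₂′} {c₁ = d₁} {d₂} swap {h = β⟨ g ⟩} {k = relabel β⟨ g ⟩}
        (realized-ends g) (relabel-ends β⟨ g ⟩) ,
      trans (cong₂ (λ b σ → scaleIf b t σ) (incident-realized at-y₁ w ≟w≡at-y₁ g) (realized-sign g))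
            (relabel-sign β⟨ g ⟩)
      where
        vertices : Fin (nV G) ⤖ VT
        vertices = ↔⇒⤖ swap-↔ ⤖-∘ α

        edges : Fin (nE G) ⤖ ET
        edges = mk⤖ {to = λ g → relabel β⟨ g ⟩}
          ( (λ {a} {c} eq → let j , σ = relabel-merges-parallel _ _ eq
                            in realized-parallel⇒≡ a c j σ)
          , strictlySurjective⇒surjective λ k →
              Bijection.to⁻ β (unrelabel k) ,
              trans (cong relabel (proj₂ (Bijection.strictlySurjective β (unrelabel k))))
                    (relabel-unrelabel k) )

    G-from-Gᵗ : Realizes G (end₁ Gᵗ) (end₂ Gᵗ) (twistSign t Gᵗ w)
    G-from-Gᵗ = Realizes-sign-cong {K = G} {d₁ = end₁ G} {end₂ G}
      (λ g → sym (scaleIf-involutive (incident G w g) t (sign G g))) (realizes-self G)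

lemma2p2 : (G₁ G₂ : SBG)
           (e₁ : Fin (nE G₁)) (x₁ y₁ : Fin (nV G₁)) →
           Joins (end₁ G₁) (end₂ G₁) x₁ y₁ e₁ →
           (e₂ : Fin (nE G₂)) (x₂ y₂ : Fin (nV G₂)) →
           Joins (end₁ G₂) (end₂ G₂) x₂ y₂ e₂ →
           (G : SBG) → Sb3' G₁ G₂ e₁ x₁ y₁ e₂ x₂ y₂ G →
           Obtainable G₁ G₂ G
lemma2p2 G₁ G₂ e₁ x₁ y₁ j₁ e₂ x₂ y₂ j₂ G r =
  obtainable-twist {H = Gᵗ G r} (op3 base₂ G₁ᵗ-obtainable (Gᵗ-by-sb3 G r))
                   t (w G r) (G-from-Gᵗ G r)
  where
    open Sb3'ViaSb3 G₁ G₂ j₁ j₂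

    G₁ᵗ-obtainable : Obtainable G₁ G₂ G₁ᵗ
    G₁ᵗ-obtainable = obtainable-twist base₁ t y₁ (realizes-self G₁ᵗ)
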